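{- Let $n \geq 4$ be an even integer and $d \geq 2$ an integer. Then Player $B$ has a winning strategy in the game $Z(n,d)$.
   Context: For integers $n \geq 4$ and $d \geq 2$, $Z(n,d)$ is the following two-player game. Initially the board contains the numbers $1,2,\dots,n$. Players $A$ and $B$ alternately cross out (remove) one number from the board, with $A$ moving first, until exactly two numbers remain. If the sum of the two remaining numbers is divisible by $d$, $A$ wins; otherwise $B$ wins. A player has a winning strategy if that player can force a win regardless of the opponent's moves. -}

module Defs where

open import Data.Nat using (ℕ; suc; _+_; _≤_)
open import Data.Nat.Divisibility using (_∣_)
open import Data.List using (List; []; _∷_; length; removeAt; applyUpTo)
open import Data.Fin using (Fin)
open import Data.Product using (Σ)
open import Relation.Nullary using (¬_)

board : ℕ → List ℕ
board n = applyUpTo suc n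

data Player : Set where
  A B : Player

-- BWins d p l : in the game Z(·,d), from the position with board l and
-- player p to move, player B has a winning strategy.
data BWins (d : ℕ) : Player → List ℕ → Set where
  done  : ∀ {p x y} → ¬ (d ∣ x + y) → BWins d p (x ∷ y ∷ [])
  moveB : ∀ {l} → 3 ≤ length l →
          Σ (Fin (length l)) (λ i → BWins d A (removeAt l i)) → BWins d B l
  moveA : ∀ {l} → 3 ≤ length l →
          ((i : Fin (length l)) → BWins d B (removeAt l i)) → BWins d A l

BHasWinningStrategy : ℕ → ℕ → Set
BHasWinningStrategy n d = BWins d A (board n)

-- Pair the board as {1,2}, {3,4}, …, {n-1,n}. Whenever A crosses out a number,
-- B crosses out its partner, so after each round the board is again a union of
-- pairs of consecutive numbers. When A moves on the last two pairs {a,a+1},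
-- {b,b+1}, one full pair {c,c+1} and a single x survive; as x + c and x + c + 1
-- are consecutive, d ≥ 2 cannot divide both, and B keeps the one it does not divide.
module Submission where

open import Defs
open import Data.Nat using (ℕ; zero; suc; _+_; _*_; _≤_; s≤s; z≤n)
open import Data.Nat.Properties using (≤-refl; +-comm; +-suc; <⇒≢)
open import Data.Nat.Divisibility using (_∣_; _∤_; divides; _∣?_; ∣1⇒≡1; ∣m+n∣m⇒∣n)
open import Data.List using (List; []; _∷_; length; removeAt; applyUpTo)
open import Data.List.Properties using (length-removeAt)
open import Data.Fin using (Fin; zero; suc)
open import Data.Product using (Σ; _,_)
open import Data.Sum using (_⊎_; inj₁; inj₂)
open import Relation.Nullary using (yes; no)
open import Relation.Binary.PropositionalEquality using (_≡_; refl; sym; subst)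

private
  variable
    d k m : ℕ
    l : List ℕ

∣⇒∤suc : 2 ≤ d → d ∣ m → d ∤ suc m
∣⇒∤suc {d} {m} 2≤d d∣m d∣1+m =
  <⇒≢ 2≤d (sym (∣1⇒≡1 (∣m+n∣m⇒∣n (subst (d ∣_) (+-comm 1 m) d∣1+m) d∣m)))

∤⊎∤suc : 2 ≤ d → ∀ m → d ∤ m ⊎ d ∤ suc m
∤⊎∤suc {d} 2≤d m with d ∣? m
... | no  d∤m = inj₁ d∤m
... | yes d∣m = inj₂ (∣⇒∤suc 2≤d d∣m)

data Pairs : ℕ → List ℕ → Set where
  []  : Pairs 0 []
  _∷_ : ∀ c → Pairs k l → Pairs (suc k) (c ∷ suc c ∷ l)

applyUpTo-pairs : ∀ (f : ℕ → ℕ) → (∀ i → f (suc i) ≡ suc (f i)) →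
                  ∀ k → Pairs k (applyUpTo f (k * 2))
applyUpTo-pairs f f-suc zero    = []
applyUpTo-pairs f f-suc (suc k) =
  subst (λ y → Pairs (suc k) (f 0 ∷ y ∷ rest)) (sym (f-suc 0)) (f 0 ∷ pairs-rest)
  where
  rest : List ℕ
  rest = applyUpTo (λ i → f (suc (suc i))) (k * 2)
  pairs-rest : Pairs k rest
  pairs-rest = applyUpTo-pairs (λ i → f (suc (suc i))) (λ i → f-suc (suc (suc i))) k

board-pairs : ∀ k → Pairs k (board (k * 2))
board-pairs = applyUpTo-pairs suc (λ _ → refl)

removeAt-partner : Pairs (suc k) l → (i : Fin (length l)) →
                   Σ (Fin (length (removeAt l i))) λ j → Pairs k (removeAt (removeAt l i) j)
removeAt-partner (c ∷ p)     zero          = zero , p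
removeAt-partner (c ∷ p)     (suc zero)    = zero , p
removeAt-partner (c ∷ b ∷ p) (suc (suc i)) with removeAt-partner (b ∷ p) i
... | j , p′ = suc (suc j) , c ∷ p′

3≤length : Pairs (suc (suc k)) l → 3 ≤ length l
3≤length (_ ∷ _ ∷ _) = s≤s (s≤s (s≤s z≤n))

3≤length-removeAt : Pairs (suc (suc (suc k))) l → (i : Fin (length l)) →
                    3 ≤ length (removeAt l i)
3≤length-removeAt {l = l} (_ ∷ _ ∷ _ ∷ _) i =
  subst (3 ≤_) (sym (length-removeAt l i)) (s≤s (s≤s (s≤s z≤n)))

module _ (2≤d : 2 ≤ d) where

  B-wins-single-pair : ∀ x c → BWins d B (x ∷ c ∷ suc c ∷ [])
  B-wins-single-pair x c with ∤⊎∤suc 2≤d (x + c)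
  ... | inj₁ d∤x+c   = moveB ≤-refl (suc (suc zero) , done d∤x+c)
  ... | inj₂ d∤1+x+c = moveB ≤-refl
                         (suc zero , done (subst (d ∤_) (sym (+-suc x c)) d∤1+x+c))

  B-wins-pair-single : ∀ c x → BWins d B (c ∷ suc c ∷ x ∷ [])
  B-wins-pair-single c x with ∤⊎∤suc 2≤d (c + x)
  ... | inj₁ d∤c+x   = moveB ≤-refl (suc zero , done d∤c+x)
  ... | inj₂ d∤1+c+x = moveB ≤-refl (zero , done d∤1+c+x)

  A-loses-on-two-pairs : ∀ a b → BWins d A (a ∷ suc a ∷ b ∷ suc b ∷ [])
  A-loses-on-two-pairs a b = moveA (3≤length (a ∷ b ∷ [])) λ where
    zero                   → B-wins-single-pair (suc a) b
    (suc zero)             → B-wins-single-pair a b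
    (suc (suc zero))       → B-wins-pair-single a (suc b)
    (suc (suc (suc zero))) → B-wins-pair-single a b

  A-loses-on-pairs : Pairs (suc (suc k)) l → BWins d A l
  A-loses-on-pairs (a ∷ b ∷ [])      = A-loses-on-two-pairs a b
  A-loses-on-pairs p@(_ ∷ _ ∷ _ ∷ _) = moveA (3≤length p) λ i →
    let j , p′ = removeAt-partner p i
    in  moveB (3≤length-removeAt p i) (j , A-loses-on-pairs p′)

theorem3p2p5 : (n d : ℕ) → 4 ≤ n → 2 ∣ n → 2 ≤ d → BHasWinningStrategy n d
theorem3p2p5 _ _ ()             (divides zero          refl) _
theorem3p2p5 _ _ (s≤s (s≤s ())) (divides (suc zero)    refl) _
theorem3p2p5 _ _ _              (divides (suc (suc k)) refl) 2≤d =
  A-loses-on-pairs 2≤d (board-pairs (suc (suc k)))
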